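{- Let $d\ge1$ and $n\ge0$ with $d$ dividing $n$. Then the poset $\Omega_n^{(d)}$ admits a recursive atom ordering, and hence is CL-shellable and Cohen–Macaulay.
   Context: $[n]=\{1,\ldots,n\}$. An ordered set partition of $[n]$ is a sequence $(B_1,\ldots,B_k)$ of nonempty pairwise disjoint sets (blocks) with union $[n]$; it is $d$-divisible if every block has size divisible by $d$. The $d$-divisible ordered set partitions of $[n]$ are ordered by: $(B_1,\ldots,B_k)$ is covered by each $(B_1,\ldots,B_{i-1},B_i\cup B_{i+1},B_{i+2},\ldots,B_k)$, extended transitively; $\Omega_n^{(d)}$ is this poset with a unique minimum $\hat0$ adjoined; its maximum is $([n])$. For a finite bounded poset $P$ with atom set $\mathcal{A}(P)$, a linear ordering $a_1,\ldots,a_t$ of $\mathcal A(P)$ is a recursive atom ordering if (R1) for every $j$, the interval $[a_j,\hat1]$ admits a recursive atom ordering in which the atoms of $[a_j,\hat 1]$ that cover some $a_i$ with $i<j$ come first, and (R2) for all $i<k$, if $a_i,a_k<y$ for some $y$, then there exist $j<k$ and $x\in P$ with $a_j\lessdot x$, $a_k\lessdot x$ and $x\le y$ ($\lessdot$ denotes covering). -}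

module Defs where

open import Level using (0ℓ)
open import Data.Nat using (ℕ)
open import Data.Nat.Divisibility using (_∣_)
open import Data.Fin using (Fin) renaming (_<_ to _<ᶠ_)
open import Data.Fin.Subset as S using (Subset; _∪_; _∩_; ∣_∣; Nonempty)
open import Data.Maybe using (Maybe; just; nothing)
open import Data.List using (List; []; _∷_; _++_; foldr; lookup)
open import Data.List.Relation.Unary.All using (All)
open import Data.List.Relation.Unary.AllPairs using (AllPairs)
open import Data.List.Relation.Unary.Unique.Propositional using (Unique)
open import Data.List.Membership.Propositional using (_∈_)
open import Data.Product using (Σ; ∃; ∃-syntax; _×_)
open import Data.Empty using (⊥)
open import Data.Unit using (⊤)
open import Relation.Nullary using (¬_)
open import Relation.Binary.PropositionalEquality using (_≡_; _≢_)
open import Relation.Binary.Construct.Closure.ReflexiveTransitive using (Star)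

-- Recursive atom orderings, for a poset P given as the elements of a
-- carrier C satisfying InP, ordered by _≤_ (P is bounded with top 1̂,
-- so the interval [x,1̂] is the set of elements of P above x).

module RAODef (C : Set) (InP : C → Set) (_≤_ : C → C → Set) where

  _<_ : C → C → Set
  x < y = x ≤ y × x ≢ y

  _⋖_ : C → C → Set
  x ⋖ y = InP x × InP y × x < y × (∀ z → InP z → x < z → z < y → ⊥)

  -- RAO x S : the interval [x,1̂] admits a recursive atom ordering in
  -- which the atoms satisfying S come first.
  data RAO : C → (C → Set) → Set₁ where
    rao : ∀ {x S}
      → (as : List C)
      → Unique as
      → All (x ⋖_) as
      → (∀ y → x ⋖ y → y ∈ as)
      → (∀ (i k : Fin _) → i <ᶠ k → S (lookup as k) → S (lookup as i))
      → (∀ (j : Fin _) → RAO (lookup as j)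
            (λ y → (lookup as j ⋖ y) × ∃[ i ] (i <ᶠ j × lookup as i ⋖ y)))
      → (∀ (i k : Fin _) (y : C) → i <ᶠ k → InP y
            → lookup as i < y → lookup as k < y
            → ∃[ j ] ∃[ z ] (j <ᶠ k × lookup as j ⋖ z × lookup as k ⋖ z × z ≤ y))
      → RAO x S

  AdmitsRAO : C → Set₁
  AdmitsRAO b = RAO b (λ _ → ⊥)

-- The poset Ω_n^(d).  An ordered set partition of [n] is a list of
-- subsets of Fin n (blocks); nothing = the adjoined minimum 0̂.

IsDivOSP : (d n : ℕ) → List (Subset n) → Set
IsDivOSP d n bs =
  All Nonempty bs
  × All (λ B → d ∣ ∣ B ∣) bs
  × AllPairs (λ B B′ → B ∩ B′ ≡ S.⊥) bs
  × foldr _∪_ S.⊥ bs ≡ S.⊤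

MergeStep : {n : ℕ} → List (Subset n) → List (Subset n) → Set
MergeStep {n} a b = Σ (List (Subset n)) λ pre → Σ (Subset n) λ B →
  Σ (Subset n) λ B′ → Σ (List (Subset n)) λ suf →
  (a ≡ pre ++ B ∷ B′ ∷ suf) × (b ≡ pre ++ (B ∪ B′) ∷ suf)

ΩCarrier : ℕ → Set
ΩCarrier n = Maybe (List (Subset n))

InΩ : (d n : ℕ) → ΩCarrier n → Set
InΩ d n nothing = ⊤
InΩ d n (just bs) = IsDivOSP d n bs

data _≤Ω_ {n : ℕ} : ΩCarrier n → ΩCarrier n → Set where
  bot≤ : ∀ {y} → nothing ≤Ω y
  merge≤ : ∀ {a b} → Star MergeStep a b → just a ≤Ω just b

OmegaAdmitsRAO : (d n : ℕ) → Set₁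
OmegaAdmitsRAO d n = RAODef.AdmitsRAO (ΩCarrier n) (InΩ d n) _≤Ω_ nothing

-- Covers in Ω are the merges of two adjacent blocks, so the interval above any ordered
-- set partition is Boolean: two distinct covers below y have a common cover below y.  Hence
-- every ordering of the atoms of such an interval satisfies (R2), and (R1) can be met by
-- listing the required atoms first.  The atoms of Ω are the partitions into blocks of size d,
-- ordered lexicographically by characteristic vectors.  If atoms α < β lie below y, then at
-- the first block where they differ α has an element x missing from β's block B and smaller
-- than some element of B; y merges B with the later blocks of β containing x.  Along that
-- run two adjacent blocks of β are out of order, and swapping one element between them
-- gives an earlier atom with a common cover with β below y.
module Submission where

open import Defs
open import Data.Nat using (ℕ; _≤_)
open import Data.Nat.Divisibility using (_∣_)

open import Data.Nat as Nat using (zero; suc; _+_; _*_; z≤n; s≤s; NonZero)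
import Data.Nat.Properties as ℕ
open import Data.Nat.Divisibility using (divides; ∣⇒≤; ∣m∣n⇒∣m+n; ∣-reflexive; n∣m*n)
open import Data.Nat.Induction using (<-wellFounded)
open import Induction.WellFounded using (Acc; acc)
open import Data.Fin using (Fin; zero; suc) renaming (_<_ to _<ᶠ_; _≤_ to _≤ᶠ_)
import Data.Fin.Properties as Fin
import Data.Bool as Bool
open import Data.Vec using ([]; _∷_; here; there)
import Data.Vec.Properties as Vec
open import Data.Fin.Subset
  using (Subset; inside; outside; _∪_; _∩_; _─_; _-_; ⁅_⁆; ∣_∣; Nonempty; ⋃; _⊆_; _∉_)
  renaming (_∈_ to _∈ₛ_; ⊥ to ∅; ⊤ to full)
open import Data.Fin.Subset.Properties
  using (_∈?_; x∈p∪q⁻; p⊆p∪q; q⊆p∪q; x∈p∩q⁺; x∈p∩q⁻; ∪-assoc; ∪-comm; ⊆-antisym; ∉⊥; Empty-unique;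
         nonempty?; ∣⊥∣≡0; ∣⊤∣≡n; x∈⁅x⁆; x∈⁅y⁆⇒x≡y; ∣⁅x⁆∣≡1; p─q⊆p; x∈p∧x∉q⇒x∈p─q;
         x∈p∧x≢y⇒x∈p-y; p⊆q⇒∣p∣≤∣q∣; drop-there)
open import Data.Maybe using (just; nothing)
open import Data.Maybe.Properties as Maybe using (just-injective)
open import Data.List using (List; []; _∷_; _++_; length; lookup; filter; map; concatMap)
open import Data.List.Properties as List using (∷-injectiveˡ; ∷-injectiveʳ)
open import Data.List.Relation.Unary.All as All using (All; []; _∷_)
open import Data.List.Relation.Unary.AllPairs as AP using (AllPairs; []; _∷_)
import Data.List.Relation.Unary.AllPairs.Properties as APₚ
open import Data.List.Relation.Unary.Any using (here; there)
import Data.List.Relation.Unary.Any as Any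
open import Data.List.Relation.Unary.Any.Properties using (lookup-index)
open import Data.List.Relation.Unary.Unique.Propositional using (Unique)
import Data.List.Relation.Unary.Unique.Propositional.Properties as Unique
open import Data.List.Membership.Propositional using (_∈_)
open import Data.List.Membership.Propositional.Properties
  using (∈-lookup; ∈-filter⁺; ∈-filter⁻; ∈-++⁺ˡ; ∈-++⁺ʳ; ∈-++⁻; ∈-map⁺; ∈-map⁻; ∈-concat⁺′)
open import Data.Product using (∃-syntax; _×_; _,_; proj₁; proj₂; uncurry)
open import Data.Sum using (_⊎_; inj₁; inj₂)
open import Data.Empty using (⊥; ⊥-elim)
open import Data.Unit using (tt)
open import Function using (_∘_; case_of_)
open import Relation.Nullary using (¬_; yes; no)
import Relation.Nullary.Decidable as Dec
open import Relation.Nullary.Decidable using (¬?; _×-dec_)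
open import Relation.Unary using (Decidable)
open import Relation.Binary.Definitions using (DecidableEquality; tri<; tri≈; tri>)
open import Relation.Binary.PropositionalEquality
  using (_≡_; _≢_; refl; sym; trans; cong; cong₂; subst; subst₂; module ≡-Reasoning)
open import Relation.Binary.Construct.Closure.ReflexiveTransitive using (Star; ε; _◅_; _◅◅_)
import Relation.Binary.Construct.Closure.ReflexiveTransitive as Star

private variable
  A : Set
  n k : ℕ
  p q r : Subset n
  B C D : Subset n
  bs cs ds ys : List (Subset n)
  x y w : Fin n

AllPairs-lookup : {R : A → A → Set} {xs : List A} → AllPairs R xs →
                  {i k : Fin (length xs)} → i <ᶠ k → R (lookup xs i) (lookup xs k)
AllPairs-lookup {xs = x ∷ xs} (Rx ∷ _)   {zero}  {suc k} _         = All.lookup Rx (∈-lookup k)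
AllPairs-lookup {xs = x ∷ xs} (_ ∷ Rxs) {suc i} {suc k} (s≤s i<k) = AllPairs-lookup Rxs i<k

AllPairs-lookup⁻ : {R : A → A → Set} → (∀ {x} → ¬ R x x) → (∀ {x y z} → R x y → R y z → R x z) →
                   {xs : List A} → AllPairs R xs → {j k : Fin (length xs)} →
                   R (lookup xs j) (lookup xs k) → j <ᶠ k
AllPairs-lookup⁻ irrefl trans sorted {j} {k} R-jk with Fin.<-cmp j k
... | tri< j<k _ _ = j<k
... | tri≈ _ refl _ = ⊥-elim (irrefl R-jk)
... | tri> _ _ k<j = ⊥-elim (irrefl (trans R-jk (AllPairs-lookup sorted k<j)))

module _ {S : A → Set} (S? : Decidable S) where

  frontload : List A → List A
  frontload xs = filter S? xs ++ filter (¬? ∘ S?) xs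

  ∈-frontload⁺ : {x : A} {xs : List A} → x ∈ xs → x ∈ frontload xs
  ∈-frontload⁺ {x} x∈xs with S? x
  ... | yes Sx = ∈-++⁺ˡ (∈-filter⁺ S? x∈xs Sx)
  ... | no ¬Sx = ∈-++⁺ʳ _ (∈-filter⁺ (¬? ∘ S?) x∈xs ¬Sx)

  ∈-frontload⁻ : {x : A} (xs : List A) → x ∈ frontload xs → x ∈ xs
  ∈-frontload⁻ xs x∈ with ∈-++⁻ (filter S? xs) x∈
  ... | inj₁ x∈ˡ = proj₁ (∈-filter⁻ S? {xs = xs} x∈ˡ)
  ... | inj₂ x∈ʳ = proj₁ (∈-filter⁻ (¬? ∘ S?) {xs = xs} x∈ʳ)

  frontload⁺ : (xs : List A) → Unique xs → Unique (frontload xs)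
  frontload⁺ xs uniq = Unique.++⁺ (Unique.filter⁺ S? uniq) (Unique.filter⁺ (¬? ∘ S?) uniq)
    λ (x∈ˡ , x∈ʳ) → proj₂ (∈-filter⁻ (¬? ∘ S?) {xs = xs} x∈ʳ) (proj₂ (∈-filter⁻ S? {xs = xs} x∈ˡ))

  frontload-front : (xs : List A) (i k : Fin (length (frontload xs))) → i <ᶠ k →
                    S (lookup (frontload xs) k) → S (lookup (frontload xs) i)
  frontload-front xs = front (filter S? xs) (filter (¬? ∘ S?) xs)
    (All.tabulate (proj₂ ∘ ∈-filter⁻ S? {xs = xs}))
    (All.tabulate (proj₂ ∘ ∈-filter⁻ (¬? ∘ S?) {xs = xs}))
    where
    front : (ys zs : List A) → All S ys → All (¬_ ∘ S) zs → (i k : Fin (length (ys ++ zs))) →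
            i <ᶠ k → S (lookup (ys ++ zs) k) → S (lookup (ys ++ zs) i)
    front []       zs _          ¬Szs i       k       _         Sk = ⊥-elim (All.lookup ¬Szs (∈-lookup k) Sk)
    front (y ∷ ys) zs (Sy ∷ _)   _    zero    k       _         _  = Sy
    front (y ∷ ys) zs (_ ∷ Sys) ¬Szs (suc i) (suc k) (s≤s i<k) Sk = front ys zs Sys ¬Szs i k i<k Sk

module RecursiveAtomOrdering {C : Set} (InP : C → Set) (_≤_ : C → C → Set) where

  open RAODef C InP _≤_

  EarlierCover : (as : List C) → Fin (length as) → C → Set
  EarlierCover as j y = (lookup as j ⋖ y) × ∃[ i ] (i <ᶠ j × lookup as i ⋖ y)

  R2 : List C → Set
  R2 as = ∀ (i k : Fin (length as)) (y : C) → i <ᶠ k → InP y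
          → lookup as i < y → lookup as k < y
          → ∃[ j ] ∃[ z ] (j <ᶠ k × lookup as j ⋖ z × lookup as k ⋖ z × z ≤ y)

  -- Q x : the atoms of [x,1̂] are listed by covers and satisfy the diamond property;
  -- in Ω these are all elements other than 0̂.
  module Diamond
    (Q : C → Set)
    (Q-⋖ : ∀ {x y} → Q x → x ⋖ y → Q y)
    (covers : ∀ {x} → Q x → List C)
    (covers-unique : ∀ {x} (q : Q x) → Unique (covers q))
    (∈-covers⁺ : ∀ {x y} (q : Q x) → x ⋖ y → y ∈ covers q)
    (∈-covers⁻ : ∀ {x y} (q : Q x) → y ∈ covers q → x ⋖ y)
    (_≟_ : DecidableEquality C)
    (rank : C → ℕ)
    (rank-⋖ : ∀ {x y} → Q x → x ⋖ y → rank y Nat.< rank x)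
    (diamond : ∀ {x a b y} → Q x → x ⋖ a → x ⋖ b → a ≢ b → InP y → a < y → b < y →
               ∃[ z ] (a ⋖ z × b ⋖ z × z ≤ y))
    where

    open import Data.List.Membership.DecPropositional _≟_ using () renaming (_∈?_ to _∈ˡ?_)

    _⋖?_ : ∀ {x} → Q x → Decidable (x ⋖_)
    q ⋖? y = Dec.map′ (∈-covers⁻ q) (∈-covers⁺ q) (y ∈ˡ? covers q)

    earlierCover? : (as : List C) → (∀ j → Q (lookup as j)) → ∀ j → Decidable (EarlierCover as j)
    earlierCover? as qs j y =
      (qs j ⋖? y) ×-dec Fin.any? (λ i → (i Fin.<? j) ×-dec (qs i ⋖? y))

    RAO-above : ∀ {x} → Q x → (S : C → Set) → Decidable S → RAO x S
    RAO-above {x} = go (<-wellFounded (rank x))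
      where
      go : ∀ {x} → Acc Nat._<_ (rank x) → Q x → (S : C → Set) → Decidable S → RAO x S
      go (acc rec) q S S? = rao as (frontload⁺ S? (covers q) (covers-unique q))
        (All.tabulate (∈-covers⁻ q ∘ ∈-frontload⁻ S? (covers q)))
        (λ y → ∈-frontload⁺ S? ∘ ∈-covers⁺ q)
        (frontload-front S? (covers q))
        (λ j → go (rec (rank-⋖ q (cover j))) (qs j) (EarlierCover as j) (earlierCover? as qs j))
        r2
        where
        as : List C
        as = frontload S? (covers q)
        cover : ∀ j → _ ⋖ lookup as j
        cover j = ∈-covers⁻ q (∈-frontload⁻ S? (covers q) (∈-lookup j))
        qs : ∀ j → Q (lookup as j)
        qs j = Q-⋖ q (cover j)
        r2 : R2 as
        r2 i k y i<k y∈P i<y k<y with diamond q (cover i) (cover k)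
          (AllPairs-lookup (frontload⁺ S? (covers q) (covers-unique q)) i<k) y∈P i<y k<y
        ... | z , i⋖z , k⋖z , z≤y = i , z , i<k , i⋖z , k⋖z , z≤y

    admitsRAO : ∀ {b} (as : List C) → Unique as → All (b ⋖_) as → (∀ y → b ⋖ y → y ∈ as) →
                (∀ j → Q (lookup as j)) → R2 as → AdmitsRAO b
    admitsRAO as uniq covers complete qs r2 =
      rao as uniq covers complete (λ _ _ _ ())
        (λ j → RAO-above (qs j) (EarlierCover as j) (earlierCover? as qs j)) r2

Disjoint : Subset n → Subset n → Set
Disjoint p q = ∀ {x} → x ∈ₛ p → x ∈ₛ q → ⊥

∩≡∅⇒Disjoint : p ∩ q ≡ ∅ → Disjoint p q
∩≡∅⇒Disjoint p∩q≡∅ x∈p x∈q = ∉⊥ (subst (_ ∈ₛ_) p∩q≡∅ (x∈p∩q⁺ (x∈p , x∈q)))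

Disjoint⇒∩≡∅ : Disjoint p q → p ∩ q ≡ ∅
Disjoint⇒∩≡∅ {p = p} {q} p#q = Empty-unique λ (x , x∈p∩q) → uncurry p#q (x∈p∩q⁻ p q x∈p∩q)

Disjoint-tail : ∀ {s t} → Disjoint (s ∷ p) (t ∷ q) → Disjoint p q
Disjoint-tail p#q x∈p x∈q = p#q (there x∈p) (there x∈q)

∣p∪q∣≡∣p∣+∣q∣ : (p q : Subset n) → Disjoint p q → ∣ p ∪ q ∣ ≡ ∣ p ∣ + ∣ q ∣
∣p∪q∣≡∣p∣+∣q∣ []            []            _   = refl
∣p∪q∣≡∣p∣+∣q∣ (inside ∷ p)  (inside ∷ q)  p#q = ⊥-elim (p#q here here)
∣p∪q∣≡∣p∣+∣q∣ (inside ∷ p)  (outside ∷ q) p#q = cong suc (∣p∪q∣≡∣p∣+∣q∣ p q (Disjoint-tail p#q))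
∣p∪q∣≡∣p∣+∣q∣ (outside ∷ p) (inside ∷ q)  p#q =
  trans (cong suc (∣p∪q∣≡∣p∣+∣q∣ p q (Disjoint-tail p#q))) (sym (ℕ.+-suc ∣ p ∣ ∣ q ∣))
∣p∪q∣≡∣p∣+∣q∣ (outside ∷ p) (outside ∷ q) p#q = ∣p∪q∣≡∣p∣+∣q∣ p q (Disjoint-tail p#q)

x∈p⇒1≤∣p∣ : x ∈ₛ p → 1 ≤ ∣ p ∣
x∈p⇒1≤∣p∣ {x = x} {p = p} x∈p = subst (_≤ ∣ p ∣) (∣⁅x⁆∣≡1 x)
  (p⊆q⇒∣p∣≤∣q∣ λ y∈⁅x⁆ → subst (_∈ₛ p) (sym (x∈⁅y⁆⇒x≡y x y∈⁅x⁆)) x∈p)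

1≤∣p∣⇒Nonempty : ∀ {n} {p : Subset n} → 1 ≤ ∣ p ∣ → Nonempty p
1≤∣p∣⇒Nonempty {n} {p} 1≤∣p∣ with nonempty? p
... | yes nonempty = nonempty
... | no  empty    = ⊥-elim (ℕ.<⇒≢ 1≤∣p∣ (sym (trans (cong ∣_∣ (Empty-unique empty)) (∣⊥∣≡0 n))))

x∈p─q⇒x∉q : x ∈ₛ p ─ q → x ∉ q
x∈p─q⇒x∉q {x = zero}  {p = _ ∷ _} {q = inside ∷ _}  ()
x∈p─q⇒x∉q {x = zero}  {p = _ ∷ _} {q = outside ∷ _} _          ()
x∈p─q⇒x∉q {x = suc _} {p = _ ∷ _} {q = _ ∷ _}       (there x∈) (there x∈q) = x∈p─q⇒x∉q x∈ x∈q

Disjoint-─ : Disjoint q (p ─ q)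
Disjoint-─ x∈q x∈p─q = x∈p─q⇒x∉q x∈p─q x∈q

p≡q∪[p─q] : q ⊆ p → p ≡ q ∪ (p ─ q)
p≡q∪[p─q] {q = q} {p = p} q⊆p = ⊆-antisym split join
  where
  split : p ⊆ q ∪ (p ─ q)
  split {x} x∈p with x ∈? q
  ... | yes x∈q = p⊆p∪q _ x∈q
  ... | no  x∉q = q⊆p∪q q _ (x∈p∧x∉q⇒x∈p─q x∈p x∉q)
  join : q ∪ (p ─ q) ⊆ p
  join x∈ with x∈p∪q⁻ q (p ─ q) x∈
  ... | inj₁ x∈q   = q⊆p x∈q
  ... | inj₂ x∈p─q = p─q⊆p p q x∈p─q

∪-cancelˡ : Disjoint p q → Disjoint p r → p ∪ q ≡ p ∪ r → q ≡ r
∪-cancelˡ {p = p} {q} {r} p#q p#r p∪q≡p∪r = ⊆-antisym (cancel p#q p∪q≡p∪r) (cancel p#r (sym p∪q≡p∪r))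
  where
  cancel : ∀ {q r} → Disjoint p q → p ∪ q ≡ p ∪ r → q ⊆ r
  cancel {q} {r} p#q eq x∈q with x∈p∪q⁻ p r (subst (_ ∈ₛ_) eq (q⊆p∪q p q x∈q))
  ... | inj₁ x∈p = ⊥-elim (p#q x∈p x∈q)
  ... | inj₂ x∈r = x∈r

p∪q≢p : x ∈ₛ q → x ∉ p → p ∪ q ≢ p
p∪q≢p {q = q} {p = p} x∈q x∉p p∪q≡p = x∉p (subst (_ ∈ₛ_) p∪q≡p (q⊆p∪q p q x∈q))

swap : Subset n → Fin n → Fin n → Subset n
swap p x w = (p - x) ∪ ⁅ w ⁆

w∈swap : w ∈ₛ swap p x w
w∈swap {w = w} {p = p} {x = x} = q⊆p∪q (p - x) ⁅ w ⁆ (x∈⁅x⁆ w)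

∈-swap⁺ : y ∈ₛ p → y ≢ x → y ∈ₛ swap p x w
∈-swap⁺ y∈p y≢x = p⊆p∪q _ (x∈p∧x≢y⇒x∈p-y y∈p y≢x)

∈-swap⁻ : y ∈ₛ swap p x w → (y ∈ₛ p × y ≢ x) ⊎ y ≡ w
∈-swap⁻ {p = p} {x = x} {w = w} y∈ with x∈p∪q⁻ (p - x) ⁅ w ⁆ y∈
... | inj₁ y∈p-x = inj₁ (p─q⊆p p ⁅ x ⁆ y∈p-x , λ { refl → x∈p─q⇒x∉q y∈p-x (x∈⁅x⁆ x) })
... | inj₂ y∈⁅w⁆ = inj₂ (x∈⁅y⁆⇒x≡y w y∈⁅w⁆)

swap-self : x ∈ₛ p → swap p x x ≡ p
swap-self {x = x} {p = p} x∈p = ⊆-antisym ⊆p p⊆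
  where
  ⊆p : swap p x x ⊆ p
  ⊆p y∈ with ∈-swap⁻ y∈
  ... | inj₁ (y∈p , _) = y∈p
  ... | inj₂ refl      = x∈p
  p⊆ : p ⊆ swap p x x
  p⊆ {y} y∈p with y Fin.≟ x
  ... | yes refl = w∈swap
  ... | no  y≢x  = ∈-swap⁺ y∈p y≢x

∣swap∣≡∣p-x∣+1 : w ∉ p - x → ∣ swap p x w ∣ ≡ ∣ p - x ∣ + 1
∣swap∣≡∣p-x∣+1 {w = w} {p = p} {x = x} w∉p-x =
  trans (∣p∪q∣≡∣p∣+∣q∣ (p - x) ⁅ w ⁆ λ y∈p-x y∈⁅w⁆ → w∉p-x (subst (_∈ₛ p - x) (x∈⁅y⁆⇒x≡y w y∈⁅w⁆) y∈p-x))
        (cong (∣ p - x ∣ +_) (∣⁅x⁆∣≡1 w))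

∣swap∣ : x ∈ₛ p → w ∉ p → ∣ swap p x w ∣ ≡ ∣ p ∣
∣swap∣ {x = x} {p = p} {w = w} x∈p w∉p = begin
  ∣ swap p x w ∣  ≡⟨ ∣swap∣≡∣p-x∣+1 {p = p} (w∉p ∘ p─q⊆p p ⁅ x ⁆) ⟩
  ∣ p - x ∣ + 1   ≡⟨ ∣swap∣≡∣p-x∣+1 {p = p} (λ x∈p-x → x∈p─q⇒x∉q x∈p-x (x∈⁅x⁆ x)) ⟨
  ∣ swap p x x ∣  ≡⟨ cong ∣_∣ (swap-self x∈p) ⟩
  ∣ p ∣           ∎
  where open ≡-Reasoning

swap⊆ : w ∈ₛ q → swap p x w ⊆ p ∪ q
swap⊆ {q = q} {p = p} w∈q y∈ with ∈-swap⁻ y∈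
... | inj₁ (y∈p , _) = p⊆p∪q q y∈p
... | inj₂ refl      = q⊆p∪q p q w∈q

swap-pair-∪ : x ∈ₛ p → w ∈ₛ q → swap p x w ∪ swap q w x ≡ p ∪ q
swap-pair-∪ {x = x} {p = p} {w = w} {q = q} x∈p w∈q = ⊆-antisym ⊆p∪q p∪q⊆
  where
  ⊆p∪q : swap p x w ∪ swap q w x ⊆ p ∪ q
  ⊆p∪q y∈ with x∈p∪q⁻ (swap p x w) (swap q w x) y∈
  ... | inj₁ y∈p′ = swap⊆ w∈q y∈p′
  ... | inj₂ y∈q′ = subst (_ ∈ₛ_) (∪-comm q p) (swap⊆ x∈p y∈q′)
  p∪q⊆ : p ∪ q ⊆ swap p x w ∪ swap q w x
  p∪q⊆ {y} y∈ with x∈p∪q⁻ p q y∈ | y Fin.≟ x | y Fin.≟ w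
  ... | inj₁ y∈p | yes refl | _      = q⊆p∪q _ _ w∈swap
  ... | inj₁ y∈p | no  y≢x  | _      = p⊆p∪q _ (∈-swap⁺ y∈p y≢x)
  ... | inj₂ y∈q | _        | yes refl = p⊆p∪q _ w∈swap
  ... | inj₂ y∈q | _        | no  y≢w  = q⊆p∪q _ _ (∈-swap⁺ y∈q y≢w)

swap-pair-disjoint : Disjoint p q → x ≢ w → Disjoint (swap p x w) (swap q w x)
swap-pair-disjoint p#q x≢w y∈p′ y∈q′ with ∈-swap⁻ y∈p′ | ∈-swap⁻ y∈q′
... | inj₁ (y∈p , _)   | inj₁ (y∈q , _)   = p#q y∈p y∈q
... | inj₁ (_ , y≢x)   | inj₂ y≡x         = y≢x y≡x
... | inj₂ y≡w         | inj₁ (_ , y≢w)   = y≢w y≡w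
... | inj₂ refl        | inj₂ refl        = x≢w refl

smallest : ℕ → Subset n → Subset n
smallest zero    _             = ∅
smallest (suc k) []            = []
smallest (suc k) (inside ∷ p)  = inside ∷ smallest k p
smallest (suc k) (outside ∷ p) = outside ∷ smallest (suc k) p

smallest⊆ : ∀ k {p : Subset n} → smallest k p ⊆ p
smallest⊆ zero                      x∈∅        = ⊥-elim (∉⊥ x∈∅)
smallest⊆ (suc k) {p = inside ∷ p}  here        = here
smallest⊆ (suc k) {p = inside ∷ p}  (there x∈) = there (smallest⊆ k x∈)
smallest⊆ (suc k) {p = outside ∷ p} (there x∈) = there (smallest⊆ (suc k) x∈)

∣smallest∣ : ∀ k (p : Subset n) → k ≤ ∣ p ∣ → ∣ smallest k p ∣ ≡ k
∣smallest∣ {n = n} zero p _ = ∣⊥∣≡0 n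
∣smallest∣ (suc k) (inside ∷ p)  (s≤s k≤) = cong suc (∣smallest∣ k p k≤)
∣smallest∣ (suc k) (outside ∷ p) k<       = ∣smallest∣ (suc k) p k<

infix 4 _≺_

data _≺_ : ∀ {n} → Subset n → Subset n → Set where
  first : (inside ∷ p) ≺ (outside ∷ q)
  next  : ∀ {s} → p ≺ q → (s ∷ p) ≺ (s ∷ q)

≺-irrefl : ¬ p ≺ p
≺-irrefl (next p≺p) = ≺-irrefl p≺p

≺-trans : p ≺ q → q ≺ r → p ≺ r
≺-trans first      (next _)   = first
≺-trans (next _)   first      = first
≺-trans (next p≺q) (next q≺r) = next (≺-trans p≺q q≺r)

swap-≺ : x ∈ₛ p → w ∉ p → w <ᶠ x → swap p x w ≺ p
swap-≺ {x = zero}  _ _ ()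
swap-≺ {x = suc x} {p = inside ∷ p}  {w = zero}  _          w∉p _          = ⊥-elim (w∉p here)
swap-≺ {x = suc x} {p = outside ∷ p} {w = zero}  _          _   _          = first
swap-≺ {x = suc x} {p = inside ∷ p}  {w = suc w} (there x∈) w∉p (s≤s w<x) =
  next (swap-≺ x∈ (w∉p ∘ there) w<x)
swap-≺ {x = suc x} {p = outside ∷ p} {w = suc w} (there x∈) w∉p (s≤s w<x) =
  next (swap-≺ x∈ (w∉p ∘ there) w<x)

-- At the first position where p and q differ, p has an element x that q
-- lacks; as ∣ p ∣ ≡ ∣ q ∣, q must have an element after x.
≺-witness : p ≺ q → ∣ p ∣ ≡ ∣ q ∣ → ∃[ x ] ∃[ y ] (x ∈ₛ p × x ∉ q × y ∈ₛ q × x <ᶠ y)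
≺-witness {q = outside ∷ q} first ∣p∣≡∣q∣ with 1≤∣p∣⇒Nonempty (subst (1 ≤_) ∣p∣≡∣q∣ (s≤s z≤n))
... | y , y∈q = zero , suc y , here , (λ ()) , there y∈q , s≤s z≤n
≺-witness {p = inside ∷ p}  (next p≺q) ∣p∣≡∣q∣ with ≺-witness p≺q (ℕ.suc-injective ∣p∣≡∣q∣)
... | x , y , x∈p , x∉q , y∈q , x<y = suc x , suc y , there x∈p , x∉q ∘ drop-there , there y∈q , s≤s x<y
≺-witness {p = outside ∷ p} (next p≺q) ∣p∣≡∣q∣ with ≺-witness p≺q ∣p∣≡∣q∣
... | x , y , x∈p , x∉q , y∈q , x<y = suc x , suc y , there x∈p , x∉q ∘ drop-there , there y∈q , s≤s x<y

inversion-or-sorted : (p q : Subset n) →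
  (∃[ x ] ∃[ w ] (x ∈ₛ p × w ∈ₛ q × w <ᶠ x)) ⊎ (∀ {x w} → x ∈ₛ p → w ∈ₛ q → x ≤ᶠ w)
inversion-or-sorted p q with Fin.any? (λ x → Fin.any? (λ w → (x ∈? p) ×-dec (w ∈? q) ×-dec (w Fin.<? x)))
... | yes (x , w , inversion) = inj₁ (x , w , inversion)
... | no  no-inversion = inj₂ λ {x} {w} x∈p w∈q → ℕ.≮⇒≥ λ w<x → no-inversion (x , w , x∈p , w∈q , w<x)

subsets : ∀ m → List (Subset m)
subsets zero    = [] ∷ []
subsets (suc m) = map (inside ∷_) (subsets m) ++ map (outside ∷_) (subsets m)

∈-subsets : (p : Subset n) → p ∈ subsets n
∈-subsets []            = here refl
∈-subsets (inside ∷ p)  = ∈-++⁺ˡ (∈-map⁺ (inside ∷_) (∈-subsets p))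
∈-subsets (outside ∷ p) = ∈-++⁺ʳ _ (∈-map⁺ (outside ∷_) (∈-subsets p))

subsets-sorted : ∀ m → AllPairs _≺_ (subsets m)
subsets-sorted zero    = [] ∷ []
subsets-sorted (suc m) = APₚ.++⁺ (next-sorted inside) (next-sorted outside)
  (All.tabulate λ p∈ → All.tabulate λ q∈ → inside≺outside p∈ q∈)
  where
  next-sorted : ∀ s → AllPairs _≺_ (map (s ∷_) (subsets m))
  next-sorted s = APₚ.map⁺ (AP.map next (subsets-sorted m))
  inside≺outside : ∀ {p q} → p ∈ map (inside ∷_) (subsets m) → q ∈ map (outside ∷_) (subsets m) → p ≺ q
  inside≺outside p∈ q∈ with ∈-map⁻ (inside ∷_) p∈ | ∈-map⁻ (outside ∷_) q∈
  ... | _ , _ , refl | _ , _ , refl = first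

∪-divisible : ∀ {d} → Disjoint B C → d ∣ ∣ B ∣ → d ∣ ∣ C ∣ → d ∣ ∣ B ∪ C ∣
∪-divisible {B = B} {C = C} {d = d} B#C d∣B d∣C =
  subst (d ∣_) (sym (∣p∪q∣≡∣p∣+∣q∣ B C B#C)) (∣m∣n⇒∣m+n d∣B d∣C)

d∣m∧m≢d⇒m≡d+[1+k]*d : ∀ {d m} → d ∣ m → 1 ≤ m → m ≢ d → ∃[ k ] m ≡ d + suc k * d
d∣m∧m≢d⇒m≡d+[1+k]*d     (divides zero          refl) ()
d∣m∧m≢d⇒m≡d+[1+k]*d {d} (divides 1             refl) _ m≢d = ⊥-elim (m≢d (ℕ.+-identityʳ d))
d∣m∧m≢d⇒m≡d+[1+k]*d     (divides (suc (suc k)) refl) _ _   = k , refl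

infix 4 _⊑_

-- bs ⊑ cs : cs arises from bs by merging runs of consecutive blocks;
-- new starts a run, glue extends it.
data _⊑_ {n} : List (Subset n) → List (Subset n) → Set where
  nil  : [] ⊑ []
  new  : bs ⊑ cs → B ∷ bs ⊑ B ∷ cs
  glue : bs ⊑ C ∷ cs → B ∷ bs ⊑ B ∪ C ∷ cs

data Merge {n} : List (Subset n) → List (Subset n) → Set where
  merge : Merge (B ∷ C ∷ bs) (B ∪ C ∷ bs)
  skip  : Merge bs cs → Merge (B ∷ bs) (B ∷ cs)

⊑-refl : (bs : List (Subset n)) → bs ⊑ bs
⊑-refl []       = nil
⊑-refl (B ∷ bs) = new (⊑-refl bs)

glue-head : C ∷ bs ⊑ D ∷ cs → B ∪ C ∷ bs ⊑ B ∪ D ∷ cs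
glue-head (new bs⊑cs)            = new bs⊑cs
glue-head {C = C} {bs = bs} {B = B} (glue {C = E} {cs = cs} bs⊑) =
  subst (λ X → B ∪ C ∷ bs ⊑ X ∷ cs) (∪-assoc B C E) (glue bs⊑)

⊑-trans : bs ⊑ cs → cs ⊑ ds → bs ⊑ ds
⊑-trans nil        nil        = nil
⊑-trans (new b⊑c)  (new c⊑d)  = new (⊑-trans b⊑c c⊑d)
⊑-trans (new b⊑c)  (glue c⊑d) = glue (⊑-trans b⊑c c⊑d)
⊑-trans (glue b⊑c) (new c⊑d)  = glue (⊑-trans b⊑c (new c⊑d))
⊑-trans {bs = B ∷ bs} (glue {C = C} b⊑c) (glue {C = D} {cs = ds} c⊑d) =
  subst (λ X → B ∷ bs ⊑ X ∷ ds) (sym (∪-assoc B C D)) (glue (⊑-trans b⊑c (glue c⊑d)))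

Merge⇒⊑ : Merge bs cs → bs ⊑ cs
Merge⇒⊑ merge    = glue (new (⊑-refl _))
Merge⇒⊑ (skip m) = new (Merge⇒⊑ m)

Merge-length : Merge bs cs → length bs ≡ suc (length cs)
Merge-length merge    = refl
Merge-length (skip m) = cong suc (Merge-length m)

⊑-length : bs ⊑ cs → length cs ≤ length bs
⊑-length nil        = z≤n
⊑-length (new b⊑c)  = s≤s (⊑-length b⊑c)
⊑-length (glue b⊑c) = ℕ.m≤n⇒m≤1+n (⊑-length b⊑c)

⊑∧length≡⇒≡ : bs ⊑ cs → length bs ≡ length cs → bs ≡ cs
⊑∧length≡⇒≡ nil          _   = refl
⊑∧length≡⇒≡ (new {B = B} b⊑c) eq = cong (B ∷_) (⊑∧length≡⇒≡ b⊑c (ℕ.suc-injective eq))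
⊑∧length≡⇒≡ (glue b⊑c)   eq  = ⊥-elim (ℕ.<-irrefl (sym (ℕ.suc-injective eq)) (⊑-length b⊑c))

⊑-⋃ : bs ⊑ cs → ⋃ bs ≡ ⋃ cs
⊑-⋃ nil                 = refl
⊑-⋃ (new {B = B} b⊑c)   = cong (B ∪_) (⊑-⋃ b⊑c)
⊑-⋃ (glue {C = C} {cs = cs} {B = B} b⊑c) = trans (cong (B ∪_) (⊑-⋃ b⊑c)) (sym (∪-assoc B C (⋃ cs)))

Merge-⋃ : Merge bs cs → ⋃ bs ≡ ⋃ cs
Merge-⋃ = ⊑-⋃ ∘ Merge⇒⊑

⊑-head : B ∷ bs ⊑ C ∷ cs → B ⊆ C
⊑-head (new _)  = λ x∈B → x∈B
⊑-head (glue _) = p⊆p∪q _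

⊑-∷⁻ : B ∷ bs ⊑ ys → (∃[ cs ] ys ≡ B ∷ cs × bs ⊑ cs) ⊎ (∃[ C ] ∃[ cs ] ys ≡ B ∪ C ∷ cs × bs ⊑ C ∷ cs)
⊑-∷⁻ (new b⊑c)  = inj₁ (_ , refl , b⊑c)
⊑-∷⁻ (glue b⊑c) = inj₂ (_ , _ , refl , b⊑c)

⊑-firstMerge : bs ⊑ cs → bs ≢ cs → ∃[ ds ] (Merge bs ds × ds ⊑ cs)
⊑-firstMerge nil                  bs≢cs = ⊥-elim (bs≢cs refl)
⊑-firstMerge (new {B = B} b⊑c)    bs≢cs with ⊑-firstMerge b⊑c (bs≢cs ∘ cong (B ∷_))
... | ds , m , d⊑c = B ∷ ds , skip m , new d⊑c
⊑-firstMerge (glue (new b⊑c))     _ = _ , merge , new b⊑c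
⊑-firstMerge (glue (glue b⊑c))    _ = _ , merge , glue-head (glue b⊑c)

MergeStep⇒Merge : MergeStep bs cs → Merge bs cs
MergeStep⇒Merge (pre , B , C , suf , refl , refl) = go pre
  where
  go : ∀ pre → Merge (pre ++ B ∷ C ∷ suf) (pre ++ B ∪ C ∷ suf)
  go []        = merge
  go (P ∷ pre) = skip (go pre)

Merge⇒MergeStep : Merge bs cs → MergeStep bs cs
Merge⇒MergeStep (merge {B = B} {C = C} {bs = bs}) = [] , B , C , bs , refl , refl
Merge⇒MergeStep (skip {B = B} m) with Merge⇒MergeStep m
... | pre , C , D , suf , refl , refl = B ∷ pre , C , D , suf , refl , refl

Star⇒⊑ : Star MergeStep bs cs → bs ⊑ cs
Star⇒⊑ ε        = ⊑-refl _
Star⇒⊑ (m ◅ ms) = ⊑-trans (Merge⇒⊑ (MergeStep⇒Merge m)) (Star⇒⊑ ms)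

Star-skip : Star MergeStep bs cs → Star MergeStep (B ∷ bs) (B ∷ cs)
Star-skip = Star.gmap _ (Merge⇒MergeStep ∘ skip ∘ MergeStep⇒Merge)

⊑⇒Star : bs ⊑ cs → Star MergeStep bs cs
⊑⇒Star nil        = ε
⊑⇒Star (new b⊑c)  = Star-skip (⊑⇒Star b⊑c)
⊑⇒Star (glue b⊑c) = Star-skip (⊑⇒Star b⊑c) ◅◅ Merge⇒MergeStep merge ◅ ε

merges : List (Subset n) → List (List (Subset n))
merges (B ∷ C ∷ bs) = (B ∪ C ∷ bs) ∷ map (B ∷_) (merges (C ∷ bs))
merges _            = []

∈-merges⁻ : cs ∈ merges bs → Merge bs cs
∈-merges⁻ {bs = B ∷ C ∷ bs} (here refl) = merge
∈-merges⁻ {bs = B ∷ C ∷ bs} (there cs∈) with ∈-map⁻ (B ∷_) cs∈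
... | _ , m∈ , refl = skip (∈-merges⁻ m∈)

∈-merges⁺ : Merge bs cs → cs ∈ merges bs
∈-merges⁺ merge                    = here refl
∈-merges⁺ (skip {bs = _ ∷ _} {B = B} m) = there (∈-map⁺ (B ∷_) (∈-merges⁺ m))

Merge⇒≢ : Merge bs cs → bs ≢ cs
Merge⇒≢ m refl = ℕ.1+n≢n (sym (Merge-length m))

Merge-⊑-cover : Merge bs cs → bs ⊑ ds → ds ⊑ cs → bs ≡ ds ⊎ ds ≡ cs
Merge-⊑-cover {bs = bs} {cs = cs} {ds = ds} m b⊑d d⊑c with length ds ℕ.≟ length bs
... | yes same = inj₁ (⊑∧length≡⇒≡ b⊑d (sym same))
... | no  ds≢bs = inj₂ (⊑∧length≡⇒≡ d⊑c (ℕ.≤-antisym ds≤cs (⊑-length d⊑c)))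
  where
  ds≤cs : length ds ≤ length cs
  ds≤cs = ℕ.≤-pred (subst (length ds Nat.<_) (Merge-length m) (ℕ.≤∧≢⇒< (⊑-length b⊑d) ds≢bs))

data Blocks {n} : List (Subset n) → Set where
  []   : Blocks []
  cons : Nonempty B → Disjoint B (⋃ bs) → Blocks bs → Blocks (B ∷ bs)

Blocks-tail : Blocks (B ∷ bs) → Blocks bs
Blocks-tail (cons _ _ bs-blocks) = bs-blocks

Merge-Blocks : Blocks bs → Merge bs cs → Blocks cs
Merge-Blocks (cons (x , x∈B) B# (cons _ C# bs)) (merge {B = B} {C = C}) =
  cons (x , p⊆p∪q C x∈B) B∪C# bs
  where
  B∪C# : Disjoint (B ∪ C) _
  B∪C# y∈B∪C y∈bs with x∈p∪q⁻ B C y∈B∪C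
  ... | inj₁ y∈B = B# y∈B (q⊆p∪q C _ y∈bs)
  ... | inj₂ y∈C = C# y∈C y∈bs
Merge-Blocks (cons {B = B} ne B# bs) (skip m) =
  cons ne (λ x∈B → B# x∈B ∘ subst (_ ∈ₛ_) (sym (Merge-⋃ m))) (Merge-Blocks bs m)

merges-unique : Blocks bs → Unique (merges bs)
merges-unique []                = []
merges-unique (cons _ _ [])     = []
merges-unique {bs = B ∷ C ∷ bs} (cons _ B# C∷bs@(cons (x , x∈C) _ _)) =
  All.tabulate distinct ∷ Unique.map⁺ ∷-injectiveʳ (merges-unique C∷bs)
  where
  distinct : ∀ {ds} → ds ∈ map (B ∷_) (merges (C ∷ bs)) → B ∪ C ∷ bs ≢ ds
  distinct ds∈ eq with ∈-map⁻ (B ∷_) ds∈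
  ... | _ , _ , refl = p∪q≢p x∈C (λ x∈B → B# x∈B (p⊆p∪q _ x∈C)) (∷-injectiveˡ eq)

⊑-head-⊆-⋃ : bs ⊑ C ∷ cs → C ⊆ ⋃ bs
⊑-head-⊆-⋃ {C = C} {cs = cs} b⊑c x∈C = subst (_ ∈ₛ_) (sym (⊑-⋃ b⊑c)) (p⊆p∪q (⋃ cs) x∈C)

⊑-head-nonempty : Blocks bs → bs ⊑ C ∷ cs → Nonempty C
⊑-head-nonempty (cons (x , x∈B) _ _) b⊑c = x , ⊑-head b⊑c x∈B

glue-disjoint : Blocks (B ∷ bs) → bs ⊑ C ∷ cs → Disjoint B C
glue-disjoint (cons _ B# _) b⊑c x∈B = B# x∈B ∘ ⊑-head-⊆-⋃ b⊑c

glue-grows : Blocks (B ∷ bs) → bs ⊑ C ∷ cs → B ∪ C ≢ B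
glue-grows B∷bs@(cons _ _ bs) b⊑c with ⊑-head-nonempty bs b⊑c
... | x , x∈C = p∪q≢p x∈C (λ x∈B → glue-disjoint B∷bs b⊑c x∈B x∈C)

-- B is disjoint from the later blocks, so it is either alone in both coarsenings or
-- glued to the same set in both.
⊑-∷-common : Blocks (B ∷ bs) → Blocks (B ∷ cs) → B ∷ bs ⊑ ys → B ∷ cs ⊑ ys →
             ∃[ ys′ ] (bs ⊑ ys′ × cs ⊑ ys′ × (∀ {ds} → ds ⊑ ys′ → B ∷ ds ⊑ ys))
⊑-∷-common B∷bs B∷cs (new b⊑) c⊑ with ⊑-∷⁻ c⊑
... | inj₁ (_ , refl , c⊑′)   = _ , b⊑ , c⊑′ , new
... | inj₂ (_ , _ , eq , c⊑′) = ⊥-elim (glue-grows B∷cs c⊑′ (sym (∷-injectiveˡ eq)))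
⊑-∷-common B∷bs B∷cs (glue b⊑) c⊑ with ⊑-∷⁻ c⊑
... | inj₁ (_ , eq , _)       = ⊥-elim (glue-grows B∷bs b⊑ (∷-injectiveˡ eq))
... | inj₂ (_ , _ , eq , c⊑′)
  with ∷-injectiveʳ eq | ∪-cancelˡ (glue-disjoint B∷bs b⊑) (glue-disjoint B∷cs c⊑′) (∷-injectiveˡ eq)
... | refl | refl = _ , b⊑ , c⊑′ , glue

∈-⋃⁻ : x ∈ₛ ⋃ bs → ∃[ B ] (B ∈ bs × x ∈ₛ B)
∈-⋃⁻ {bs = []}     x∈ = ⊥-elim (∉⊥ x∈)
∈-⋃⁻ {bs = B ∷ bs} x∈ with x∈p∪q⁻ B (⋃ bs) x∈
... | inj₁ x∈B  = B , here refl , x∈B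
... | inj₂ x∈bs with ∈-⋃⁻ x∈bs
...   | C , C∈bs , x∈C = C , there C∈bs , x∈C

∈-⋃⁺ : B ∈ bs → x ∈ₛ B → x ∈ₛ ⋃ bs
∈-⋃⁺ (here refl) x∈B = p⊆p∪q _ x∈B
∈-⋃⁺ (there B∈)  x∈B = q⊆p∪q _ _ (∈-⋃⁺ B∈ x∈B)

Blocks⁺ : All Nonempty bs → AllPairs (λ B C → B ∩ C ≡ ∅) bs → Blocks bs
Blocks⁺ []          []             = []
Blocks⁺ (ne ∷ nes) (B∩≡∅ ∷ pairs) = cons ne B# (Blocks⁺ nes pairs)
  where
  B# : Disjoint _ _
  B# x∈B x∈bs with ∈-⋃⁻ x∈bs
  ... | C , C∈bs , x∈C = ∩≡∅⇒Disjoint (All.lookup B∩≡∅ C∈bs) x∈B x∈C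

Blocks⁻ : Blocks bs → All Nonempty bs × AllPairs (λ B C → B ∩ C ≡ ∅) bs
Blocks⁻ []                 = [] , []
Blocks⁻ (cons ne B# blocks) =
  ne ∷ proj₁ (Blocks⁻ blocks) ,
  All.tabulate (λ C∈bs → Disjoint⇒∩≡∅ λ x∈B x∈C → B# x∈B (∈-⋃⁺ C∈bs x∈C)) ∷ proj₂ (Blocks⁻ blocks)

blocks? : Decidable (Blocks {n})
blocks? bs = Dec.map′ (uncurry Blocks⁺) Blocks⁻
  (All.all? nonempty? bs ×-dec AP.allPairs? (λ B C → Vec.≡-dec Bool._≟_ (B ∩ C) ∅) bs)

Merge-All : {P : Subset n → Set} → (∀ {B C} → Disjoint B C → P B → P C → P (B ∪ C)) →
            Blocks bs → All P bs → Merge bs cs → All P cs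
Merge-All ∪-closed (cons _ B# _) (PB ∷ PC ∷ Ps) merge    =
  ∪-closed (λ x∈B → B# x∈B ∘ p⊆p∪q _) PB PC ∷ Ps
Merge-All ∪-closed blocks        (PB ∷ Ps)      (skip m) =
  PB ∷ Merge-All ∪-closed (Blocks-tail blocks) Ps m

Uniform : ℕ → List (Subset n) → Set
Uniform k = All (λ B → ∣ B ∣ ≡ k)

∣⋃∣ : ∀ {n k} {bs : List (Subset n)} → Blocks bs → Uniform k bs → ∣ ⋃ bs ∣ ≡ length bs * k
∣⋃∣ {n} [] [] = ∣⊥∣≡0 n
∣⋃∣ {bs = B ∷ bs} (cons _ B# blocks) (∣B∣ ∷ uniform) =
  trans (∣p∪q∣≡∣p∣+∣q∣ B (⋃ bs) B#) (cong₂ _+_ ∣B∣ (∣⋃∣ blocks uniform))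

⊑-uniform-rigid : ∀ {d} → Blocks bs → All (λ B → d ∣ ∣ B ∣) bs → Uniform d cs → bs ⊑ cs → bs ≡ cs
⊑-uniform-rigid _      _            _                nil        = refl
⊑-uniform-rigid blocks (_ ∷ div)    (_ ∷ uniform)    (new b⊑c)  =
  cong (_ ∷_) (⊑-uniform-rigid (Blocks-tail blocks) div uniform b⊑c)
⊑-uniform-rigid {d = d} blocks@(cons (x , x∈B) _ bs) (d∣B ∷ _) (∣B∪C∣ ∷ _) (glue {C = C} {B = B} b⊑c)
  with ⊑-head-nonempty bs b⊑c
... | y , y∈C = ⊥-elim (ℕ.m+1+n≰m d (begin
  d + 1            ≤⟨ ℕ.+-mono-≤ (∣⇒≤ {{Nat.>-nonZero (x∈p⇒1≤∣p∣ x∈B)}} d∣B) (x∈p⇒1≤∣p∣ y∈C) ⟩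
  ∣ B ∣ + ∣ C ∣    ≡⟨ ∣p∪q∣≡∣p∣+∣q∣ B C (glue-disjoint blocks b⊑c) ⟨
  ∣ B ∪ C ∣        ≡⟨ ∣B∪C∣ ⟩
  d                ∎))
  where open ℕ.≤-Reasoning

split-block : ∀ d .{{_ : NonZero d}} {k} → Blocks (B ∷ bs) → ∣ B ∣ ≡ d + suc k * d →
              ∃[ B₁ ] ∃[ B₂ ] (Blocks (B₁ ∷ B₂ ∷ bs) × ∣ B₁ ∣ ≡ d × ∣ B₂ ∣ ≡ suc k * d ×
                               Merge (B₁ ∷ B₂ ∷ bs) (B ∷ bs))
split-block {B = B} {bs = bs} d {k} (cons _ B# blocks) ∣B∣≡ =
  B₁ , B₂ , cons (size⇒nonempty ∣B₁∣ (Nat.>-nonZero⁻¹ d)) B₁#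
              (cons (size⇒nonempty ∣B₂∣ (ℕ.≤-trans (Nat.>-nonZero⁻¹ d) (ℕ.m≤m+n d (k * d))))
                    (B# ∘ p─q⊆p B B₁) blocks) ,
  ∣B₁∣ , ∣B₂∣ , subst (λ X → Merge (B₁ ∷ B₂ ∷ bs) (X ∷ bs)) (sym B≡B₁∪B₂) merge
  where
  B₁ B₂ : Subset _
  B₁ = smallest d B
  B₂ = B ─ B₁
  size⇒nonempty : ∀ {p : Subset _} {m} → ∣ p ∣ ≡ m → 1 ≤ m → Nonempty p
  size⇒nonempty ∣p∣≡m 1≤m = 1≤∣p∣⇒Nonempty (subst (1 ≤_) (sym ∣p∣≡m) 1≤m)
  B≡B₁∪B₂ : B ≡ B₁ ∪ B₂
  B≡B₁∪B₂ = p≡q∪[p─q] (smallest⊆ d)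
  ∣B₁∣ : ∣ B₁ ∣ ≡ d
  ∣B₁∣ = ∣smallest∣ d B (subst (d ≤_) (sym ∣B∣≡) (ℕ.m≤m+n d _))
  ∣B₂∣ : ∣ B₂ ∣ ≡ suc k * d
  ∣B₂∣ = ℕ.+-cancelˡ-≡ d _ _ (begin
    d + ∣ B₂ ∣       ≡⟨ cong (_+ ∣ B₂ ∣) ∣B₁∣ ⟨
    ∣ B₁ ∣ + ∣ B₂ ∣  ≡⟨ ∣p∪q∣≡∣p∣+∣q∣ B₁ B₂ Disjoint-─ ⟨
    ∣ B₁ ∪ B₂ ∣      ≡⟨ cong ∣_∣ B≡B₁∪B₂ ⟨
    ∣ B ∣            ≡⟨ ∣B∣≡ ⟩
    d + suc k * d    ∎)
    where open ≡-Reasoning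
  B₁# : Disjoint B₁ (B₂ ∪ ⋃ bs)
  B₁# x∈B₁ x∈ with x∈p∪q⁻ B₂ (⋃ bs) x∈
  ... | inj₁ x∈B₂ = Disjoint-─ x∈B₁ x∈B₂
  ... | inj₂ x∈bs = B# (smallest⊆ d x∈B₁) x∈bs

unsplittable⇒uniform : ∀ d .{{_ : NonZero d}} {bs : List (Subset n)} →
  Blocks bs → All (λ B → d ∣ ∣ B ∣) bs →
  (∀ {as} → Blocks as → All (λ B → d ∣ ∣ B ∣) as → ¬ Merge as bs) → Uniform d bs
unsplittable⇒uniform d [] [] _ = []
unsplittable⇒uniform d {B ∷ bs} blocks@(cons ne B# bs-blocks) (d∣B ∷ div) unsplittable with ∣ B ∣ ℕ.≟ d
... | yes ∣B∣≡d = ∣B∣≡d ∷ unsplittable⇒uniform d bs-blocks div λ as-blocks as-div m →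
  unsplittable (cons ne (λ x∈B → B# x∈B ∘ subst (_ ∈ₛ_) (Merge-⋃ m)) as-blocks) (d∣B ∷ as-div) (skip m)
... | no ∣B∣≢d with d∣m∧m≢d⇒m≡d+[1+k]*d d∣B (x∈p⇒1≤∣p∣ (proj₂ ne)) ∣B∣≢d
...   | k , ∣B∣≡ with split-block d {k} blocks ∣B∣≡
...     | _ , _ , split , ∣B₁∣ , ∣B₂∣ , m =
  ⊥-elim (unsplittable split (∣-reflexive (sym ∣B₁∣) ∷ subst (d ∣_) (sym ∣B₂∣) (n∣m*n (suc k)) ∷ div) m)

merge-skip-diamond : Blocks (B ∷ C ∷ bs) → Merge (C ∷ bs) ds → B ∪ C ∷ bs ⊑ ys → B ∷ ds ⊑ ys →
                     ∃[ zs ] (Merge (B ∪ C ∷ bs) zs × Merge (B ∷ ds) zs × zs ⊑ ys)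
merge-skip-diamond (cons _ B# (cons (x , x∈C) _ _)) _ c⊑ (new _) =
  ⊥-elim (B# (⊑-head c⊑ (q⊆p∪q _ _ x∈C)) (p⊆p∪q _ x∈C))
merge-skip-diamond {B = B} {C = C} (cons _ _ (cons _ _ (cons {B = D} {bs = bs} _ _ _))) merge _ (glue d⊑) =
  B ∪ (C ∪ D) ∷ bs , subst (λ X → Merge (B ∪ C ∷ D ∷ bs) (X ∷ bs)) (∪-assoc B C D) merge , merge ,
  glue-head d⊑
merge-skip-diamond {B = B} {C = C} _ (skip {cs = ds} m) _ (glue d⊑) =
  B ∪ C ∷ ds , skip m , merge , glue-head d⊑

Merge-diamond : Blocks bs → Merge bs cs → Merge bs ds → cs ≢ ds → cs ⊑ ys → ds ⊑ ys →
                ∃[ zs ] (Merge cs zs × Merge ds zs × zs ⊑ ys)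
Merge-diamond _      merge    merge    cs≢ds _  _  = ⊥-elim (cs≢ds refl)
Merge-diamond blocks merge    (skip m) _     c⊑ d⊑ = merge-skip-diamond blocks m c⊑ d⊑
Merge-diamond blocks (skip m) merge    _     c⊑ d⊑ with merge-skip-diamond blocks m d⊑ c⊑
... | zs , d→z , c→z , z⊑ = zs , c→z , d→z , z⊑
Merge-diamond blocks (skip {B = B} m) (skip m′) cs≢ds c⊑ d⊑
  with ⊑-∷-common (Merge-Blocks blocks (skip m)) (Merge-Blocks blocks (skip m′)) c⊑ d⊑
... | ys′ , c⊑′ , d⊑′ , lift
  with Merge-diamond (Blocks-tail blocks) m m′ (cs≢ds ∘ cong (B ∷_)) c⊑′ d⊑′
... | zs , c→z , d→z , z⊑ = B ∷ zs , skip c→z , skip d→z , lift z⊑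

infix 4 _<ˡ_

data _<ˡ_ {n} : List (Subset n) → List (Subset n) → Set where
  first : B ≺ C → B ∷ bs <ˡ C ∷ cs
  next  : bs <ˡ cs → B ∷ bs <ˡ B ∷ cs

<ˡ-irrefl : ¬ bs <ˡ bs
<ˡ-irrefl (first B≺B)   = ≺-irrefl B≺B
<ˡ-irrefl (next bs<bs) = <ˡ-irrefl bs<bs

<ˡ-trans : bs <ˡ cs → cs <ˡ ds → bs <ˡ ds
<ˡ-trans (first B≺C) (first C≺D) = first (≺-trans B≺C C≺D)
<ˡ-trans (first B≺C) (next _)    = first B≺C
<ˡ-trans (next _)    (first C≺D) = first C≺D
<ˡ-trans (next b<c)  (next c<d)  = next (<ˡ-trans b<c c<d)

-- The witness (R2) asks for, at the level of block lists.
EarlierPartner : ℕ → List (Subset n) → List (Subset n) → Set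
EarlierPartner k bs ys = ∃[ cs ] ∃[ zs ]
  (cs <ˡ bs × Blocks cs × Uniform k cs × Merge bs zs × Merge cs zs × zs ⊑ ys)

EarlierPartner-∷ : ∀ {ys′} → Blocks (B ∷ bs) → ∣ B ∣ ≡ k → (∀ {ds} → ds ⊑ ys′ → B ∷ ds ⊑ ys) →
                   EarlierPartner k bs ys′ → EarlierPartner k (B ∷ bs) ys
EarlierPartner-∷ {B = B} (cons ne B# _) ∣B∣≡k lift
                 (cs , zs , cs<bs , cs-blocks , cs-uniform , bs→zs , cs→zs , zs⊑) =
  B ∷ cs , B ∷ zs , next cs<bs ,
  cons ne (λ x∈B → B# x∈B ∘ subst (_ ∈ₛ_) (trans (Merge-⋃ cs→zs) (sym (Merge-⋃ bs→zs)))) cs-blocks ,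
  ∣B∣≡k ∷ cs-uniform , skip bs→zs , skip cs→zs , lift zs⊑

EarlierPartner-⊑ : ∀ {ys′} → EarlierPartner k bs ys → ys ⊑ ys′ → EarlierPartner k bs ys′
EarlierPartner-⊑ (cs , zs , cs<bs , blocks , uniform , bs→zs , cs→zs , zs⊑) ys⊑ =
  cs , zs , cs<bs , blocks , uniform , bs→zs , cs→zs , ⊑-trans zs⊑ ys⊑

-- Moving the smaller w forward and x back makes the first block lexicographically smaller.
swap-adjacent : Blocks (B ∷ C ∷ bs) → Uniform k (B ∷ C ∷ bs) → x ∈ₛ B → w ∈ₛ C → w <ᶠ x →
                EarlierPartner k (B ∷ C ∷ bs) (B ∪ C ∷ bs)
swap-adjacent {B = B} {C = C} {bs = bs} {x = x} {w = w}
              (cons _ B# (cons _ C# bs-blocks)) (∣B∣ ∷ ∣C∣ ∷ uniform) x∈B w∈C w<x =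
  swap B x w ∷ swap C w x ∷ bs , B ∪ C ∷ bs , first (swap-≺ x∈B w∉B w<x) ,
  cons (w , w∈swap) B′# (cons (x , w∈swap) (B∪C#bs ∘ C′⊆B∪C) bs-blocks) ,
  trans (∣swap∣ x∈B w∉B) ∣B∣ ∷ trans (∣swap∣ w∈C x∉C) ∣C∣ ∷ uniform ,
  merge , subst (λ X → Merge (swap B x w ∷ swap C w x ∷ bs) (X ∷ bs)) (swap-pair-∪ x∈B w∈C) merge ,
  ⊑-refl _
  where
  B#C : Disjoint B C
  B#C x∈B x∈C = B# x∈B (p⊆p∪q _ x∈C)
  w∉B : w ∉ B
  w∉B w∈B = B#C w∈B w∈C
  x∉C : x ∉ C
  x∉C = B#C x∈B
  B∪C#bs : Disjoint (B ∪ C) (⋃ bs)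
  B∪C#bs y∈ y∈bs with x∈p∪q⁻ B C y∈
  ... | inj₁ y∈B = B# y∈B (q⊆p∪q C _ y∈bs)
  ... | inj₂ y∈C = C# y∈C y∈bs
  C′⊆B∪C : swap C w x ⊆ B ∪ C
  C′⊆B∪C = subst (_ ∈ₛ_) (∪-comm C B) ∘ swap⊆ x∈B
  B′# : Disjoint (swap B x w) (swap C w x ∪ ⋃ bs)
  B′# y∈B′ y∈ with x∈p∪q⁻ (swap C w x) (⋃ bs) y∈
  ... | inj₁ y∈C′ = swap-pair-disjoint B#C (λ x≡w → Fin.<-irrefl (sym x≡w) w<x) y∈B′ y∈C′
  ... | inj₂ y∈bs = B∪C#bs (swap⊆ w∈C y∈B′) y∈bs

-- x lies in a later block of the run merged into B ∪ C than y ∈ B, but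
-- x < y; somewhere along the run two adjacent blocks are out of order.
exchange-run : Blocks (B ∷ bs) → Uniform k (B ∷ bs) → bs ⊑ C ∷ cs → y ∈ₛ B → x ∈ₛ C → x <ᶠ y →
               EarlierPartner k (B ∷ bs) (B ∪ C ∷ cs)
exchange-run {bs = []} _ _ () _ _ _
exchange-run {B = B} {bs = B′ ∷ bs} blocks uniform b⊑ y∈B x∈C x<y with inversion-or-sorted B B′
... | inj₁ (u , v , u∈B , v∈B′ , v<u) =
  EarlierPartner-⊑ (swap-adjacent blocks uniform u∈B v∈B′ v<u) (glue-head b⊑)
... | inj₂ sorted with b⊑
...   | new _ = ⊥-elim (ℕ.<⇒≱ x<y (sorted y∈B x∈C))
...   | glue {C = C′} b⊑′ with x∈p∪q⁻ B′ C′ x∈C | Blocks-tail blocks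
...     | inj₁ x∈B′ | _ = ⊥-elim (ℕ.<⇒≱ x<y (sorted y∈B x∈B′))
...     | inj₂ x∈C′ | B′∷bs@(cons (y′ , y′∈B′) _ _) =
  EarlierPartner-∷ blocks (All.head uniform) glue
    (exchange-run B′∷bs (All.tail uniform) b⊑′ y′∈B′ x∈C′ (ℕ.<-≤-trans x<y (sorted y∈B y′∈B′)))

exchange : cs <ˡ bs → Blocks cs → Blocks bs → Uniform k cs → Uniform k bs → cs ⊑ ys → bs ⊑ ys →
           EarlierPartner k bs ys
exchange (first B≺C) _ blocks (∣B∣ ∷ _) (∣C∣ ∷ uniform) c⊑ b⊑
  with ≺-witness B≺C (trans ∣B∣ (sym ∣C∣)) | ⊑-∷⁻ b⊑
... | x , y , x∈B , x∉C , y∈C , x<y | inj₁ (_ , refl , _) = ⊥-elim (x∉C (⊑-head c⊑ x∈B))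
... | x , y , x∈B , x∉C , y∈C , x<y | inj₂ (D , _ , refl , b⊑′) with x∈p∪q⁻ _ D (⊑-head c⊑ x∈B)
...   | inj₁ x∈C = ⊥-elim (x∉C x∈C)
...   | inj₂ x∈D = exchange-run blocks (∣C∣ ∷ uniform) b⊑′ y∈C x∈D x<y
exchange (next c<b) cs-blocks bs-blocks (∣B∣ ∷ cs-uniform) (_ ∷ bs-uniform) c⊑ b⊑
  with ⊑-∷-common cs-blocks bs-blocks c⊑ b⊑
... | _ , c⊑′ , b⊑′ , lift =
  EarlierPartner-∷ bs-blocks ∣B∣ lift
    (exchange c<b (Blocks-tail cs-blocks) (Blocks-tail bs-blocks) cs-uniform bs-uniform c⊑′ b⊑′)

blockLists : ℕ → List (List (Subset n))
blockLists zero    = [] ∷ []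
blockLists (suc k) = concatMap (λ B → map (B ∷_) (blockLists k)) (subsets _)

∈-blockLists : (bs : List (Subset n)) → bs ∈ blockLists (length bs)
∈-blockLists []       = here refl
∈-blockLists (B ∷ bs) = ∈-concat⁺′ (∈-map⁺ (B ∷_) (∈-blockLists bs)) (∈-map⁺ _ (∈-subsets B))

blockLists-sorted : ∀ k → AllPairs _<ˡ_ (blockLists {n} k)
blockLists-sorted zero    = [] ∷ []
blockLists-sorted {n} (suc k) =
  APₚ.concat⁺ (All.tabulate row-sorted) (APₚ.map⁺ (AP.map rows-ordered (subsets-sorted n)))
  where
  row : Subset n → List (List (Subset n))
  row B = map (B ∷_) (blockLists k)
  row-sorted : ∀ {bss} → bss ∈ map row (subsets n) → AllPairs _<ˡ_ bss
  row-sorted bss∈ with ∈-map⁻ row bss∈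
  ... | _ , _ , refl = APₚ.map⁺ (AP.map next (blockLists-sorted k))
  rows-ordered : ∀ {B C} → B ≺ C → All (λ bs → All (bs <ˡ_) (row C)) (row B)
  rows-ordered {B} {C} B≺C = All.tabulate λ bs∈ → All.tabulate λ cs∈ → ordered bs∈ cs∈
    where
    ordered : ∀ {bs cs} → bs ∈ row B → cs ∈ row C → bs <ˡ cs
    ordered bs∈ cs∈ with ∈-map⁻ (B ∷_) bs∈ | ∈-map⁻ (C ∷_) cs∈
    ... | _ , _ , refl | _ , _ , refl = first B≺C

module Omega (d n : ℕ) .{{_ : NonZero d}} where

  open RAODef (ΩCarrier n) (InΩ d n) _≤Ω_
  open RecursiveAtomOrdering (InΩ d n) _≤Ω_

  Divisible : List (Subset n) → Set
  Divisible = All (λ B → d ∣ ∣ B ∣)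

  osp⁻ : IsDivOSP d n bs → Blocks bs × Divisible bs × ⋃ bs ≡ full
  osp⁻ (nonempty , divisible , disjoint , cover) = Blocks⁺ nonempty disjoint , divisible , cover

  osp⁺ : Blocks bs → Divisible bs → ⋃ bs ≡ full → IsDivOSP d n bs
  osp⁺ blocks divisible cover = proj₁ (Blocks⁻ blocks) , divisible , proj₂ (Blocks⁻ blocks) , cover

  Merge-osp : IsDivOSP d n bs → Merge bs cs → IsDivOSP d n cs
  Merge-osp osp m with osp⁻ osp
  ... | blocks , divisible , cover =
    osp⁺ (Merge-Blocks blocks m) (Merge-All ∪-divisible blocks divisible m) (trans (sym (Merge-⋃ m)) cover)

  ≤Ω⇒⊑ : just bs ≤Ω just cs → bs ⊑ cs
  ≤Ω⇒⊑ (merge≤ steps) = Star⇒⊑ steps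

  ⊑⇒≤Ω : bs ⊑ cs → just bs ≤Ω just cs
  ⊑⇒≤Ω = merge≤ ∘ ⊑⇒Star

  just≰nothing : ¬ just bs ≤Ω nothing
  just≰nothing ()

  Merge⇒⋖ : IsDivOSP d n bs → Merge bs cs → just bs ⋖ just cs
  Merge⇒⋖ {bs = bs} {cs = cs} osp m =
    osp , Merge-osp osp m , (⊑⇒≤Ω (Merge⇒⊑ m) , Merge⇒≢ m ∘ just-injective) , nothing-between
    where
    nothing-between : ∀ z → InΩ d n z → just bs < z → z < just cs → ⊥
    nothing-between nothing   _ (() , _) _
    nothing-between (just ds) _ (b≤d , b≢d) (d≤c , d≢c) with Merge-⊑-cover m (≤Ω⇒⊑ b≤d) (≤Ω⇒⊑ d≤c)
    ... | inj₁ bs≡ds = b≢d (cong just bs≡ds)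
    ... | inj₂ ds≡cs = d≢c (cong just ds≡cs)

  _≟Ω_ : DecidableEquality (ΩCarrier n)
  _≟Ω_ = Maybe.≡-dec (List.≡-dec (Vec.≡-dec Bool._≟_))

  ⋖⇒Merge : ∀ {y} → just bs ⋖ y → ∃[ cs ] (y ≡ just cs × Merge bs cs)
  ⋖⇒Merge {y = nothing} (_ , _ , (() , _) , _)
  ⋖⇒Merge {y = just cs} (osp , _ , (b≤c , b≢c) , nothing-between)
    with ⊑-firstMerge (≤Ω⇒⊑ b≤c) (b≢c ∘ cong just)
  ... | ds , m , d⊑c with just ds ≟Ω just cs
  ...   | yes refl = cs , refl , m
  ...   | no  d≢c  = ⊥-elim (nothing-between (just ds) (Merge-osp osp m)
                               (⊑⇒≤Ω (Merge⇒⊑ m) , Merge⇒≢ m ∘ just-injective) (⊑⇒≤Ω d⊑c , d≢c))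

  IsOSP : ΩCarrier n → Set
  IsOSP nothing   = ⊥
  IsOSP (just bs) = IsDivOSP d n bs

  IsOSP-⋖ : ∀ {x y} → IsOSP x → x ⋖ y → IsOSP y
  IsOSP-⋖ {just _} osp x⋖y with ⋖⇒Merge x⋖y
  ... | _ , refl , m = Merge-osp osp m

  covers : ∀ {x} → IsOSP x → List (ΩCarrier n)
  covers {just bs} _ = map just (merges bs)

  covers-unique : ∀ {x} (osp : IsOSP x) → Unique (covers osp)
  covers-unique {just _} osp = Unique.map⁺ just-injective (merges-unique (proj₁ (osp⁻ osp)))

  ∈-covers⁺ : ∀ {x y} (osp : IsOSP x) → x ⋖ y → y ∈ covers osp
  ∈-covers⁺ {just _} _ x⋖y with ⋖⇒Merge x⋖y
  ... | _ , refl , m = ∈-map⁺ just (∈-merges⁺ m)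

  ∈-covers⁻ : ∀ {x y} (osp : IsOSP x) → y ∈ covers osp → x ⋖ y
  ∈-covers⁻ {just _} osp y∈ with ∈-map⁻ just y∈
  ... | _ , cs∈ , refl = Merge⇒⋖ osp (∈-merges⁻ cs∈)

  rank : ΩCarrier n → ℕ
  rank nothing   = 0
  rank (just bs) = length bs

  rank-⋖ : ∀ {x y} → IsOSP x → x ⋖ y → rank y Nat.< rank x
  rank-⋖ {just _} _ x⋖y with ⋖⇒Merge x⋖y
  ... | _ , refl , m = ℕ.≤-reflexive (sym (Merge-length m))

  diamond : ∀ {x a b y} → IsOSP x → x ⋖ a → x ⋖ b → a ≢ b → InΩ d n y → a < y → b < y →
            ∃[ z ] (a ⋖ z × b ⋖ z × z ≤Ω y)
  diamond {just _} osp x⋖a x⋖b a≢b _ (a≤y , _) (b≤y , _) with ⋖⇒Merge x⋖a | ⋖⇒Merge x⋖b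
  diamond {just _} {y = nothing} _ _ _ _ _ (a≤y , _) _ | _ , refl , _ | _ = ⊥-elim (just≰nothing a≤y)
  diamond {just _} {y = just _} osp _ _ a≢b _ (a≤y , _) (b≤y , _) | _ , refl , m | _ , refl , m′
    with Merge-diamond (proj₁ (osp⁻ osp)) m m′ (a≢b ∘ cong just) (≤Ω⇒⊑ a≤y) (≤Ω⇒⊑ b≤y)
  ... | zs , c→z , d→z , z⊑y =
    just zs , Merge⇒⋖ (Merge-osp osp m) c→z , Merge⇒⋖ (Merge-osp osp m′) d→z , ⊑⇒≤Ω z⊑y

  open Diamond IsOSP IsOSP-⋖ covers covers-unique ∈-covers⁺ ∈-covers⁻ _≟Ω_ rank rank-⋖ diamond

  IsAtom : List (Subset n) → Set
  IsAtom bs = Blocks bs × Uniform d bs × ⋃ bs ≡ full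

  isAtom? : Decidable IsAtom
  isAtom? bs = blocks? bs ×-dec All.all? (λ B → ∣ B ∣ ℕ.≟ d) bs ×-dec Vec.≡-dec Bool._≟_ (⋃ bs) full

  atom⇒osp : IsAtom bs → IsDivOSP d n bs
  atom⇒osp (blocks , uniform , cover) = osp⁺ blocks (All.map (∣-reflexive ∘ sym) uniform) cover

  atom⇒⋖ : IsAtom bs → nothing ⋖ just bs
  atom⇒⋖ {bs = bs} atom@(_ , uniform , _) = tt , atom⇒osp atom , (bot≤ , λ ()) , nothing-between
    where
    nothing-between : ∀ z → InΩ d n z → nothing < z → z < just bs → ⊥
    nothing-between nothing   _   (_ , 0̂≢0̂) _           = 0̂≢0̂ refl
    nothing-between (just cs) osp _          (c≤b , c≢b) with osp⁻ osp
    ... | blocks , divisible , _ = c≢b (cong just (⊑-uniform-rigid blocks divisible uniform (≤Ω⇒⊑ c≤b)))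

  ⋖⇒atom : nothing ⋖ just bs → IsAtom bs
  ⋖⇒atom (_ , osp , _ , nothing-between) with osp⁻ osp
  ... | blocks , divisible , cover = blocks , unsplittable⇒uniform d blocks divisible unsplittable , cover
    where
    unsplittable : ∀ {as} → Blocks as → Divisible as → ¬ Merge as _
    unsplittable {as} as-blocks as-divisible m =
      nothing-between (just as) (osp⁺ as-blocks as-divisible (trans (Merge-⋃ m) cover))
        (bot≤ , λ ()) (⊑⇒≤Ω (Merge⇒⊑ m) , Merge⇒≢ m ∘ just-injective)

  atom-length : ∀ q {bs : List (Subset n)} → n ≡ q * d → IsAtom bs → length bs ≡ q
  atom-length q {bs} n≡q*d (blocks , uniform , cover) = ℕ.*-cancelʳ-≡ (length bs) q d (begin
    length bs * d  ≡⟨ ∣⋃∣ blocks uniform ⟨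
    ∣ ⋃ bs ∣       ≡⟨ cong ∣_∣ cover ⟩
    ∣ full {n} ∣   ≡⟨ ∣⊤∣≡n n ⟩
    n              ≡⟨ n≡q*d ⟩
    q * d          ∎)
    where open ≡-Reasoning

  atom-exchange : ∀ {α β y} → IsAtom α → IsAtom β → α <ˡ β → just α < y → just β < y →
                  ∃[ γ ] ∃[ z ] (γ <ˡ β × IsAtom γ × just γ ⋖ z × just β ⋖ z × z ≤Ω y)
  atom-exchange {y = nothing} _ _ _ (α≤y , _) _ = ⊥-elim (just≰nothing α≤y)
  atom-exchange {y = just ys} (α-blocks , α-uniform , _) β-atom@(β-blocks , β-uniform , β-cover) α<β
                (α≤y , _) (β≤y , _)
    with exchange α<β α-blocks β-blocks α-uniform β-uniform (≤Ω⇒⊑ α≤y) (≤Ω⇒⊑ β≤y)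
  ... | γ , zs , γ<β , γ-blocks , γ-uniform , β→z , γ→z , z⊑y =
    γ , just zs , γ<β , γ-atom , Merge⇒⋖ (atom⇒osp γ-atom) γ→z , Merge⇒⋖ (atom⇒osp β-atom) β→z , ⊑⇒≤Ω z⊑y
    where
    γ-atom : IsAtom γ
    γ-atom = γ-blocks , γ-uniform , trans (Merge-⋃ γ→z) (trans (sym (Merge-⋃ β→z)) β-cover)

  _<Ω_ : ΩCarrier n → ΩCarrier n → Set
  just bs <Ω just cs = bs <ˡ cs
  _       <Ω _       = ⊥

  <Ω-irrefl : ∀ {x} → ¬ x <Ω x
  <Ω-irrefl {just _} = <ˡ-irrefl

  <Ω-trans : ∀ {x y z} → x <Ω y → y <Ω z → x <Ω z
  <Ω-trans {just _} {just _} {just _} = <ˡ-trans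

  module Atoms (q : ℕ) (n≡q*d : n ≡ q * d) where

    atoms : List (ΩCarrier n)
    atoms = map just (filter isAtom? (blockLists q))

    ∈-atoms⁺ : ∀ {bs} → IsAtom bs → just bs ∈ atoms
    ∈-atoms⁺ {bs} atom = ∈-map⁺ just (∈-filter⁺ isAtom?
      (subst (λ k → bs ∈ blockLists k) (atom-length q n≡q*d atom) (∈-blockLists bs)) atom)

    ∈-atoms⁻ : ∀ {x} → x ∈ atoms → ∃[ bs ] (x ≡ just bs × IsAtom bs)
    ∈-atoms⁻ x∈ with ∈-map⁻ just x∈
    ... | bs , bs∈ , refl = bs , refl , proj₂ (∈-filter⁻ isAtom? {xs = blockLists q} bs∈)

    atoms-sorted : AllPairs _<Ω_ atoms
    atoms-sorted = APₚ.map⁺ (APₚ.filter⁺ isAtom? (blockLists-sorted q))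

    atoms-unique : Unique atoms
    atoms-unique = AP.map (λ {x} x<y x≡y → <Ω-irrefl (subst (x <Ω_) (sym x≡y) x<y)) atoms-sorted

    atomAt : (i : Fin (length atoms)) → ∃[ bs ] (lookup atoms i ≡ just bs × IsAtom bs)
    atomAt i = ∈-atoms⁻ (∈-lookup i)

    atoms-covers : All (nothing ⋖_) atoms
    atoms-covers = All.tabulate λ x∈ → case ∈-atoms⁻ x∈ of λ where
      (_ , refl , atom) → atom⇒⋖ atom

    atoms-complete : ∀ y → nothing ⋖ y → y ∈ atoms
    atoms-complete nothing   (_ , _ , (_ , 0̂≢0̂) , _) = ⊥-elim (0̂≢0̂ refl)
    atoms-complete (just bs) 0̂⋖bs                  = ∈-atoms⁺ (⋖⇒atom 0̂⋖bs)

    atoms-osp : ∀ i → IsOSP (lookup atoms i)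
    atoms-osp i with atomAt i
    ... | _ , atom≡ , atom = subst IsOSP (sym atom≡) (atom⇒osp atom)

    atoms-R2 : R2 atoms
    atoms-R2 i k y i<k _ i<y k<y with atomAt i | atomAt k | AllPairs-lookup atoms-sorted i<k
    ... | α , α≡ , α-atom | β , β≡ , β-atom | i<Ωk
      with atom-exchange α-atom β-atom (subst₂ _<Ω_ α≡ β≡ i<Ωk) (subst (_< y) α≡ i<y) (subst (_< y) β≡ k<y)
    ... | γ , z , γ<β , γ-atom , γ⋖z , β⋖z , z≤y =
      j , z , AllPairs-lookup⁻ <Ω-irrefl <Ω-trans atoms-sorted (subst₂ _<Ω_ γ≡ (sym β≡) γ<β) ,
      subst (_⋖ z) γ≡ γ⋖z , subst (_⋖ z) (sym β≡) β⋖z , z≤y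
      where
      γ∈ : just γ ∈ atoms
      γ∈ = ∈-atoms⁺ γ-atom
      j : Fin (length atoms)
      j = Any.index γ∈
      γ≡ : just γ ≡ lookup atoms j
      γ≡ = lookup-index γ∈

  Ω-admitsRAO : d ∣ n → OmegaAdmitsRAO d n
  Ω-admitsRAO (divides q n≡q*d) =
    admitsRAO atoms atoms-unique atoms-covers atoms-complete atoms-osp atoms-R2
    where open Atoms q n≡q*d

mainTheorem3 : (d n : ℕ) → 1 ≤ d → d ∣ n → OmegaAdmitsRAO d n
mainTheorem3 d n 1≤d = Omega.Ω-admitsRAO d n {{Nat.>-nonZero 1≤d}}
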